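{- Let $\mathbf S=(S,\leq,*,1)$ be a skew Hilbert algebra and $\Theta$ a strong congruence on $\mathbf S$. Then for all $x,y\in S$: $(x,y)\in\Theta$ if and only if $x*y,\,y*x\in[1]\Theta$; that is, $\Phi([1]\Theta)=\Theta$.
   Context: For a poset and a subset $A$, $L(A)$, $U(A)$ are the sets of lower and upper bounds; $L(U(x,y),z)=L(U(\{x,y\})\cup\{z\})$. A skew Hilbert algebra is a poset $(S,\leq,*,1)$ with binary operation $*$ and constant $1$ such that for all $x,y,z$: (S1) $x\leq y$ iff $x*y=1$; (S2) if $y*x=1$ then $x*((x*y)*y)=1$; (S3) if $x*y=1$ then $(y*z)*(x*z)=1$; (S4) $L(U(x,y),x*y)=L(y)$. An algebraic congruence is a congruence of $(S,*)$; on $S/\Theta$ set $[a]\Theta\leq'[b]\Theta$ iff $[a*b]\Theta=[1]\Theta$. $\Theta$ is strong if for all $a,b$: $[a]\Theta\leq'[b]\Theta$ iff there is $c\in[b]\Theta$ with $a\leq c$ and $b\leq c$. $\Theta$ is min-stable if $(a,b),(c,d)\in\Theta$ with $a,c$ comparable and $b,d$ comparable imply $(\min(a,c),\min(b,d))\in\Theta$. A strong congruence is a strong, min-stable algebraic congruence. For $M\subseteq S$, $\Phi(M)=\{(x,y)\in S^2\mid x*y,y*x\in M\}$. -}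

module Defs where

open import Level using (Level; _⊔_; suc)
open import Data.Product using (_×_; Σ-syntax; ∃-syntax)
open import Data.Sum using (_⊎_)
open import Relation.Binary.PropositionalEquality using (_≡_)
open import Relation.Binary.Core using (Rel)
open import Relation.Binary.Structures using (IsEquivalence)

record SkewHilbertAlgebra (a ℓ : Level) : Set (suc (a ⊔ ℓ)) where
  infixr 5 _*_
  infix 4 _≤_
  field
    S       : Set a
    _≤_     : S → S → Set ℓ
    _*_     : S → S → S
    𝟏       : S
    ≤-refl  : ∀ {x} → x ≤ x
    ≤-antisym : ∀ {x y} → x ≤ y → y ≤ x → x ≡ y
    ≤-trans : ∀ {x y z} → x ≤ y → y ≤ z → x ≤ z
    S1a : ∀ {x y} → x ≤ y → x * y ≡ 𝟏
    S1b : ∀ {x y} → x * y ≡ 𝟏 → x ≤ y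
    S2  : ∀ {x y} → y * x ≡ 𝟏 → x * ((x * y) * y) ≡ 𝟏
    S3  : ∀ {x y z} → x * y ≡ 𝟏 → (y * z) * (x * z) ≡ 𝟏

  IsUpper₂ : S → S → S → Set ℓ
  IsUpper₂ x y u = (x ≤ u) × (y ≤ u)

  InLUz : S → S → S → S → Set (a ⊔ ℓ)
  InLUz x y z w = (∀ u → IsUpper₂ x y u → w ≤ u) × (w ≤ z)

  field
    -- (S4)  L(U(x,y), x*y) = L(y)  (as sets of elements)
    S4a : ∀ {x y w} → InLUz x y (x * y) w → w ≤ y
    S4b : ∀ {x y w} → w ≤ y → InLUz x y (x * y) w

module _ {a ℓ : Level} (𝐒 : SkewHilbertAlgebra a ℓ) where
  open SkewHilbertAlgebra 𝐒

  record IsAlgebraicCongruence {r} (Θ : Rel S r) : Set (a ⊔ r) where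
    field
      isEquivalence : IsEquivalence Θ
      *-cong : ∀ {x y u v} → Θ x y → Θ u v → Θ (x * u) (y * v)

  -- the induced relation on S/Θ, on representatives:
  -- [a]Θ ≤' [b]Θ  iff  [a*b]Θ = [1]Θ
  _≤'[_]_ : ∀ {r} → S → Rel S r → S → Set r
  x ≤'[ Θ ] y = Θ (x * y) 𝟏

  Comparable : S → S → Set ℓ
  Comparable x y = (x ≤ y) ⊎ (y ≤ x)

  minOf : ∀ {x y} → Comparable x y → S
  minOf {x} {y} (Data.Sum.inj₁ _) = x
  minOf {x} {y} (Data.Sum.inj₂ _) = y

  IsStrongRel : ∀ {r} → Rel S r → Set (a ⊔ ℓ ⊔ r)
  IsStrongRel Θ = ∀ x y →
    ((x ≤'[ Θ ] y) → ∃[ c ] (Θ c y × x ≤ c × y ≤ c))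
    × ((∃[ c ] (Θ c y × x ≤ c × y ≤ c)) → x ≤'[ Θ ] y)

  IsMinStable : ∀ {r} → Rel S r → Set (a ⊔ ℓ ⊔ r)
  IsMinStable Θ = ∀ {x y u v} → Θ x y → Θ u v →
    (p : Comparable x u) → (q : Comparable y v) → Θ (minOf p) (minOf q)

  record IsStrongCongruence {r} (Θ : Rel S r) : Set (a ⊔ ℓ ⊔ r) where
    field
      isAlgebraicCongruence : IsAlgebraicCongruence Θ
      isStrong    : IsStrongRel Θ
      isMinStable : IsMinStable Θ

  Φ : ∀ {r} → (S → Set r) → Rel S r
  Φ M x y = M (x * y) × M (y * x)

  classOf𝟏 : ∀ {r} → Rel S r → S → Set r
  classOf𝟏 Θ x = Θ x 𝟏

-- If x*y and y*x lie in [1]Θ, strongness yields c ∈ [y]Θ above x and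
-- d ∈ [x]Θ above y; min-stability applied to the pairs (c,y) and (x,d)
-- then gives (min(c,x), min(y,d)) = (x,y) ∈ Θ.  The converse is just
-- compatibility of Θ with * together with x*x = 1.
module Submission where

open import Defs
open import Level using (Level)
open import Data.Product using (_,_; proj₁)
open import Data.Sum using (inj₁; inj₂)
open import Relation.Binary.Core using (Rel; _⇒_)
open import Relation.Binary.Definitions using (Symmetric)
open import Relation.Binary.Structures using (IsEquivalence)
open import Relation.Binary.PropositionalEquality using (_≡_; subst)
open import Function.Bundles using (_⇔_; mk⇔)

module _ {a ℓ : Level} (𝐒 : SkewHilbertAlgebra a ℓ) where
  open SkewHilbertAlgebra 𝐒

  x*x≡𝟏 : ∀ x → x * x ≡ 𝟏
  x*x≡𝟏 x = S1a ≤-refl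

  module _ {r} {Θ : Rel S r} (isCong : IsAlgebraicCongruence 𝐒 Θ) where
    open IsAlgebraicCongruence isCong
    open IsEquivalence isEquivalence

    Θ⇒Φ[𝟏]Θ : Θ ⇒ Φ 𝐒 (classOf𝟏 𝐒 Θ)
    Θ⇒Φ[𝟏]Θ {x} {y} θxy = *-into-class𝟏 θxy , *-into-class𝟏 (sym θxy)
      where
      *-into-class𝟏 : ∀ {u v} → Θ u v → Θ (u * v) 𝟏
      *-into-class𝟏 {u} {v} θuv = subst (Θ (u * v)) (x*x≡𝟏 v) (*-cong θuv refl)

  strong∧minStable⇒Φ[𝟏]Θ⇒Θ : ∀ {r} {Θ : Rel S r} → Symmetric Θ →
    IsStrongRel 𝐒 Θ → IsMinStable 𝐒 Θ → Φ 𝐒 (classOf𝟏 𝐒 Θ) ⇒ Θ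
  strong∧minStable⇒Φ[𝟏]Θ⇒Θ sym strong minStable {x} {y} (x*y∈[𝟏] , y*x∈[𝟏])
    with proj₁ (strong x y) x*y∈[𝟏] | proj₁ (strong y x) y*x∈[𝟏]
  ... | c , θcy , x≤c , _ | d , θdx , y≤d , _ =
    minStable θcy (sym θdx) (inj₂ x≤c) (inj₁ y≤d)

mainTheorem14 : ∀ {a ℓ r : Level} (𝐒 : SkewHilbertAlgebra a ℓ)
    (Θ : Rel (SkewHilbertAlgebra.S 𝐒) r) → IsStrongCongruence 𝐒 Θ →
    ∀ x y → Θ x y ⇔ Φ 𝐒 (classOf𝟏 𝐒 Θ) x y
mainTheorem14 𝐒 Θ isStrongCong x y =
  mk⇔ (Θ⇒Φ[𝟏]Θ 𝐒 isAlgebraicCongruence)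
      (strong∧minStable⇒Φ[𝟏]Θ⇒Θ 𝐒 (IsEquivalence.sym isEquivalence) isStrong isMinStable)
  where
  open IsStrongCongruence isStrongCong
  open IsAlgebraicCongruence isAlgebraicCongruence
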